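{- Let $\delta\ge1$ and let $a(n)=an^\delta+a'n^{\delta-1}+\cdots$, $b(n)=bn^\delta+b'n^{\delta-1}+\cdots$, $c(n)=cn^\delta+c'n^{\delta-1}+\cdots$ be real polynomials in $n$ of degree $\delta$ with positive leading coefficients $a,b,c$, taking positive values for all integers $n\ge1$. Let $(u_n)_{n\ge0}$ be a real sequence satisfying $$a(n)u_{n+1}=b(n)u_n-c(n)u_{n-1},\qquad n=1,2,\ldots.$$ Define $$B(n)=b(n+1)a(n)-b(n)a(n+1),\qquad C(n)=c(n+1)a(n)-c(n)a(n+1),$$ and $B=ba'-b'a$, $C=ca'-c'a$ (these are the coefficients of $n^{2\delta-2}$ in $B(n)$ and $C(n)$). Let $Q_n(\lambda)=a(n)\lambda^2-b(n)\lambda+c(n)$. Suppose $B,C>0$ and let $\lambda_0=C/B$. (i) If $u_1\ge\lambda_0u_0>0$ and $Q_n(\lambda_0)\le0$ for all $n\ge1$, then $u_n>0$ for all $n\ge0$. (ii) If $u_n>0$ for all $n\ge0$, $C\,B(n)\ge B\,C(n)\ge0$ for all $n\ge1$, and $u_2/u_1\ge u_1/u_0\ge\lambda_0$, then $(u_n)_{n\ge0}$ is log-convex, i.e. $u_{n-1}u_{n+1}\ge u_n^2$ for all $n\ge1$. -}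

module Defs where

open import Level using (Level; _⊔_) renaming (suc to lsuc)
open import Data.Nat using (ℕ; zero; suc)
open import Data.Product using (Σ; _×_; ∃)
open import Relation.Nullary using (¬_)
open import Relation.Binary.Structures using (IsTotalOrder)
open import Algebra.Bundles using (CommutativeRing)

-- An axiomatisation of the real numbers: a complete, totally ordered field.
-- (Classically every model is isomorphic to ℝ.)  Equality is the ring's
-- setoid equality _≈_.
record RealField (c ℓ : Level) : Set (lsuc (c ⊔ ℓ)) where
  field
    commRing : CommutativeRing c ℓ
  open CommutativeRing commRing public hiding (zero)
  infix 4 _≤_ _<_
  infix 8 _⁻¹
  field
    _≤_           : Carrier → Carrier → Set ℓ
    isTotalOrder  : IsTotalOrder _≈_ _≤_
    +-mono-≤      : ∀ {x y} z → x ≤ y → x + z ≤ y + z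
    *-nonneg      : ∀ {x y} → 0# ≤ x → 0# ≤ y → 0# ≤ x * y
    0≉1           : ¬ (0# ≈ 1#)
    _⁻¹           : Carrier → Carrier
    ⁻¹-inverse    : ∀ x → ¬ (x ≈ 0#) → x * x ⁻¹ ≈ 1#
    lub           : (P : Carrier → Set (c ⊔ ℓ)) →
                    (Σ Carrier P) →
                    (Σ Carrier λ m → ∀ x → P x → x ≤ m) →
                    Σ Carrier λ s → (∀ x → P x → x ≤ s)
                                  × (∀ m → (∀ x → P x → x ≤ m) → s ≤ m)

  _<_ : Carrier → Carrier → Set ℓ
  x < y = (x ≤ y) × ¬ (x ≈ y)

  _/_ : Carrier → Carrier → Carrier
  x / y = x * y ⁻¹

  ι : ℕ → Carrier
  ι zero    = 0#
  ι (suc n) = 1# + ι n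

  _^_ : Carrier → ℕ → Carrier
  x ^ zero  = 1#
  x ^ suc k = x * (x ^ k)

  -- a polynomial of degree ≤ δ is given by its coefficient function p,
  -- p i = coefficient of X^i (coefficients with i > δ are ignored);
  -- eval δ p x = Σ_{i=0}^{δ} p i * x^i
  eval : ℕ → (ℕ → Carrier) → Carrier → Carrier
  eval zero    p x = p zero
  eval (suc k) p x = eval k p x + p (suc k) * x ^ suc k

-- Both parts are proved by induction, propagating one sign condition on a
-- quadratic expression in three consecutive terms, each time via an explicit
-- ring identity whose right-hand side is a sum of products of known-nonnegative
-- factors.  For (i) the invariant is u_{n+1} ≥ λ₀ u_n, and
--   a(n) λ₀ (u_{n+1} − λ₀ u_n) = c(n) (u_n − λ₀ u_{n−1}) − u_n Q_n(λ₀).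
-- For (ii) the invariant is the pair u_{n−1} u_{n+1} ≥ u_n² and
-- B u_{n+1} ≥ C u_n: the second follows from the first, and the first one
-- step later follows from both, the recurrence and C B(n) ≥ B C(n) ≥ 0.
-- Neither the polynomial form of a, b, c nor the positivity of b and of the
-- leading coefficients is used.
module Submission where

open import Defs
open import Data.Nat using (ℕ; zero; suc)
open import Data.Product using (_×_; _,_; proj₁; proj₂)
open import Data.Sum using (inj₁; inj₂)
open import Data.Maybe using (Maybe; just; nothing)
open import Algebra using (CommutativeRing)
open import Relation.Nullary using (¬_; yes; no)
open import Relation.Binary.Structures using (IsTotalOrder)
import Relation.Binary.PropositionalEquality as ≡
import Data.Nat as ℕ
import Data.Nat.Properties as ℕ
open import Data.Integer as ℤ using (ℤ; +_; -[1+_]; _⊖_; _◃_)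
import Data.Integer.Properties as ℤ
open import Data.Sign as Sign using (Sign)
open import Algebra.Solver.Ring.AlmostCommutativeRing
  using (_-Raw-AlmostCommutative⟶_; fromCommutativeRing)

-- Integer coefficients let the normal forms detect cancellations such as
-- x - x = 0, which Tactic.RingSolver (coefficients in the carrier itself)
-- cannot decide in an abstract ring.
module ℤ-Solver {c ℓ} (R : CommutativeRing c ℓ) where
  open CommutativeRing R
  open import Algebra.Properties.Ring ring
    using (-0#≈0#; -‿involutive; -‿distribˡ-*; -‿distribʳ-*)
  open import Algebra.Properties.AbelianGroup +-abelianGroup using (⁻¹-∙-comm)
  open import Algebra.Properties.Semiring.Mult semiring
    using (×-homo-+; ×1-homo-*; ×-congˡ) renaming (_×_ to _·_)
  open import Relation.Binary.Reasoning.Setoid setoid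

  ⟦_⟧ : ℤ → Carrier
  ⟦ + n ⟧      = n · 1#
  ⟦ -[1+ n ] ⟧ = - (suc n · 1#)

  1+x-1+y≈x-y : ∀ x y → (1# + x) - (1# + y) ≈ x - y
  1+x-1+y≈x-y x y = begin
    (1# + x) + - (1# + y)    ≈⟨ +-cong (+-comm 1# x) (sym (⁻¹-∙-comm 1# y)) ⟩
    (x + 1#) + (- 1# + - y)  ≈⟨ +-assoc x 1# _ ⟩
    x + (1# + (- 1# + - y))  ≈⟨ +-congˡ (+-assoc 1# (- 1#) (- y)) ⟨
    x + ((1# + - 1#) + - y)  ≈⟨ +-congˡ (+-congʳ (-‿inverseʳ 1#)) ⟩
    x + (0# + - y)           ≈⟨ +-congˡ (+-identityˡ _) ⟩
    x - y                    ∎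

  ⊖-homo : ∀ m n → ⟦ m ⊖ n ⟧ ≈ m · 1# - n · 1#
  ⊖-homo zero    zero    = sym (-‿inverseʳ 0#)
  ⊖-homo zero    (suc n) = sym (+-identityˡ _)
  ⊖-homo (suc m) zero    = sym (trans (+-congˡ -0#≈0#) (+-identityʳ _))
  ⊖-homo (suc m) (suc n) rewrite ℤ.[1+m]⊖[1+n]≡m⊖n m n =
    trans (⊖-homo m n) (sym (1+x-1+y≈x-y _ _))

  +-homo : ∀ i j → ⟦ i ℤ.+ j ⟧ ≈ ⟦ i ⟧ + ⟦ j ⟧
  +-homo (+ m)      (+ n)      = ×-homo-+ 1# m n
  +-homo (+ m)      -[1+ n ]   = ⊖-homo m (suc n)
  +-homo -[1+ m ]   (+ n)      = trans (⊖-homo n (suc m)) (+-comm _ _)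
  +-homo -[1+ m ]   -[1+ n ]   = begin
    - (suc (suc (m ℕ.+ n)) · 1#)       ≈⟨ -‿cong (×-congˡ (≡.cong suc (ℕ.+-suc m n))) ⟨
    - ((suc m ℕ.+ suc n) · 1#)         ≈⟨ -‿cong (×-homo-+ 1# (suc m) (suc n)) ⟩
    - (suc m · 1# + suc n · 1#)        ≈⟨ ⁻¹-∙-comm _ _ ⟨
    - (suc m · 1#) + - (suc n · 1#)    ∎

  signed : Sign → Carrier → Carrier
  signed Sign.+ x = x
  signed Sign.- x = - x

  ◃-homo : ∀ s n → ⟦ s ◃ n ⟧ ≈ signed s (n · 1#)
  ◃-homo Sign.+ zero    = refl
  ◃-homo Sign.+ (suc n) = refl
  ◃-homo Sign.- zero    = sym -0#≈0#
  ◃-homo Sign.- (suc n) = refl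

  *-homo : ∀ i j → ⟦ i ℤ.* j ⟧ ≈ ⟦ i ⟧ * ⟦ j ⟧
  *-homo (+ m) (+ n) = trans (◃-homo Sign.+ (m ℕ.* n)) (×1-homo-* m n)
  *-homo (+ m) -[1+ n ] = begin
    ⟦ Sign.- ◃ (m ℕ.* suc n) ⟧   ≈⟨ ◃-homo Sign.- (m ℕ.* suc n) ⟩
    - ((m ℕ.* suc n) · 1#)       ≈⟨ -‿cong (×1-homo-* m (suc n)) ⟩
    - (m · 1# * suc n · 1#)      ≈⟨ -‿distribʳ-* _ _ ⟩
    m · 1# * - (suc n · 1#)      ∎
  *-homo -[1+ m ] (+ n) = begin
    ⟦ Sign.- ◃ (suc m ℕ.* n) ⟧   ≈⟨ ◃-homo Sign.- (suc m ℕ.* n) ⟩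
    - ((suc m ℕ.* n) · 1#)       ≈⟨ -‿cong (×1-homo-* (suc m) n) ⟩
    - (suc m · 1# * n · 1#)      ≈⟨ -‿distribˡ-* _ _ ⟩
    - (suc m · 1#) * n · 1#      ∎
  *-homo -[1+ m ] -[1+ n ] = begin
    ⟦ Sign.+ ◃ (suc m ℕ.* suc n) ⟧      ≈⟨ ◃-homo Sign.+ (suc m ℕ.* suc n) ⟩
    (suc m ℕ.* suc n) · 1#              ≈⟨ ×1-homo-* (suc m) (suc n) ⟩
    x * y                               ≈⟨ -‿involutive _ ⟨
    - - (x * y)                         ≈⟨ -‿cong (-‿distribˡ-* x y) ⟩
    - (- x * y)                         ≈⟨ -‿distribʳ-* (- x) y ⟩
    - x * - y                           ∎
    where x = suc m · 1#; y = suc n · 1#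

  -‿homo : ∀ i → ⟦ ℤ.- i ⟧ ≈ - ⟦ i ⟧
  -‿homo (+ zero)  = sym -0#≈0#
  -‿homo (+ suc n) = refl
  -‿homo -[1+ n ]  = sym (-‿involutive _)

  ℤ-homomorphism : ℤ.+-*-rawRing -Raw-AlmostCommutative⟶ fromCommutativeRing R
  ℤ-homomorphism = record
    { ⟦_⟧ = ⟦_⟧ ; +-homo = +-homo ; *-homo = *-homo ; -‿homo = -‿homo
    ; 0-homo = refl ; 1-homo = +-identityʳ 1# }

  ≟-reflected : ∀ i j → Maybe (⟦ i ⟧ ≈ ⟦ j ⟧)
  ≟-reflected i j with i ℤ.≟ j
  ... | yes ≡.refl = just refl
  ... | no _       = nothing

  open import Algebra.Solver.Ring ℤ.+-*-rawRing (fromCommutativeRing R)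
    ℤ-homomorphism ≟-reflected public using (solve; _:=_; _:+_; _:-_; _:*_; :-_)

module RealFieldProperties {c ℓ} (R : RealField c ℓ) where
  open RealField R
  open import Algebra.Properties.Ring ring using (-‿involutive; -‿distribˡ-*; -‿distribʳ-*)
  open ℤ-Solver commRing using (solve; _:=_; _:+_; _:-_; _:*_)
  module ≤ = IsTotalOrder isTotalOrder

  0≤-resp-≈ : ∀ {x y} → x ≈ y → 0# ≤ x → 0# ≤ y
  0≤-resp-≈ x≈y 0≤x = ≤.trans 0≤x (≤.reflexive x≈y)

  x≤y⇒0≤y-x : ∀ {x y} → x ≤ y → 0# ≤ y - x
  x≤y⇒0≤y-x {x} x≤y = ≤.trans (≤.reflexive (sym (-‿inverseʳ x))) (+-mono-≤ (- x) x≤y)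

  0≤y-x⇒x≤y : ∀ {x y} → 0# ≤ y - x → x ≤ y
  0≤y-x⇒x≤y {x} {y} 0≤y-x = ≤.trans (≤.reflexive (sym (+-identityˡ x)))
    (≤.trans (+-mono-≤ x 0≤y-x) (≤.reflexive (solve 2 (λ x y → (y :- x) :+ x := y) refl x y)))

  x≤0⇒0≤-x : ∀ {x} → x ≤ 0# → 0# ≤ - x
  x≤0⇒0≤-x x≤0 = 0≤-resp-≈ (+-identityˡ _) (x≤y⇒0≤y-x x≤0)

  0≤-x⇒x≤0 : ∀ {x} → 0# ≤ - x → x ≤ 0#
  0≤-x⇒x≤0 0≤-x = 0≤y-x⇒x≤y (0≤-resp-≈ (sym (+-identityˡ _)) 0≤-x)

  +-nonneg : ∀ {x y} → 0# ≤ x → 0# ≤ y → 0# ≤ x + y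
  +-nonneg {x} {y} 0≤x 0≤y =
    ≤.trans 0≤y (≤.trans (≤.reflexive (sym (+-identityˡ y))) (+-mono-≤ y 0≤x))

  0≤1 : 0# ≤ 1#
  0≤1 with ≤.total 0# 1#
  ... | inj₁ 0≤1 = 0≤1
  ... | inj₂ 1≤0 = 0≤-resp-≈ -1*-1≈1 (*-nonneg (x≤0⇒0≤-x 1≤0) (x≤0⇒0≤-x 1≤0))
    where
    -1*-1≈1 : - 1# * - 1# ≈ 1#
    -1*-1≈1 = trans (sym (-‿distribˡ-* 1# (- 1#)))
                    (trans (-‿cong (*-identityˡ _)) (-‿involutive 1#))

  <⇒≉ : ∀ {x} → 0# < x → ¬ (x ≈ 0#)
  <⇒≉ 0<x x≈0 = proj₂ 0<x (sym x≈0)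

  x*y≈0⇒y≈0 : ∀ {x y} → ¬ (x ≈ 0#) → x * y ≈ 0# → y ≈ 0#
  x*y≈0⇒y≈0 {x} {y} x≉0 xy≈0 = begin
    y                  ≈⟨ *-identityˡ y ⟨
    1# * y             ≈⟨ *-congʳ (⁻¹-inverse x x≉0) ⟨
    (x * x ⁻¹) * y     ≈⟨ solve 3 (λ x x' y → (x :* x') :* y := x' :* (x :* y)) refl x (x ⁻¹) y ⟩
    x ⁻¹ * (x * y)     ≈⟨ *-congˡ xy≈0 ⟩
    x ⁻¹ * 0#          ≈⟨ zeroʳ _ ⟩
    0#                 ∎
    where open import Relation.Binary.Reasoning.Setoid setoid

  *-cancelˡ-nonneg : ∀ {x y} → 0# < x → 0# ≤ x * y → 0# ≤ y
  *-cancelˡ-nonneg {x} {y} 0<x 0≤xy with ≤.total 0# y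
  ... | inj₁ 0≤y = 0≤y
  ... | inj₂ y≤0 = ≤.reflexive (sym (x*y≈0⇒y≈0 (<⇒≉ 0<x) xy≈0))
    where
    xy≈0 : x * y ≈ 0#
    xy≈0 = ≤.antisym (0≤-x⇒x≤0 (0≤-resp-≈ (sym (-‿distribʳ-* x y))
                                 (*-nonneg (proj₁ 0<x) (x≤0⇒0≤-x y≤0))))
                     0≤xy

  *-pos : ∀ {x y} → 0# < x → 0# < y → 0# < x * y
  *-pos 0<x 0<y = *-nonneg (proj₁ 0<x) (proj₁ 0<y) ,
    λ 0≈xy → <⇒≉ 0<y (x*y≈0⇒y≈0 (<⇒≉ 0<x) (sym 0≈xy))

  *-cancelˡ-pos : ∀ {x y} → 0# < x → 0# < x * y → 0# < y
  *-cancelˡ-pos 0<x 0<xy = *-cancelˡ-nonneg 0<x (proj₁ 0<xy) ,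
    λ 0≈y → proj₂ 0<xy (sym (trans (*-congˡ (sym 0≈y)) (zeroʳ _)))

  <-≤-trans : ∀ {x y} → 0# < x → x ≤ y → 0# < y
  <-≤-trans 0<x x≤y = ≤.trans (proj₁ 0<x) x≤y ,
    λ 0≈y → proj₂ 0<x (≤.antisym (proj₁ 0<x) (≤.trans x≤y (≤.reflexive (sym 0≈y))))

  ⁻¹-pos : ∀ {x} → 0# < x → 0# < x ⁻¹
  ⁻¹-pos {x} 0<x = *-cancelˡ-nonneg 0<x (0≤-resp-≈ (sym (⁻¹-inverse x (<⇒≉ 0<x))) 0≤1) ,
    λ 0≈x⁻¹ → 0≉1 (trans (sym (zeroʳ x)) (trans (*-congˡ 0≈x⁻¹) (⁻¹-inverse x (<⇒≉ 0<x))))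

  /-pos : ∀ {x y} → 0# < x → 0# < y → 0# < x / y
  /-pos 0<x 0<y = *-pos 0<x (⁻¹-pos 0<y)

  cross-multiply : ∀ {p q x y} → 0# < p → 0# < q → y / p ≤ x / q → y * q ≤ p * x
  cross-multiply {p} {q} {x} {y} 0<p 0<q y/p≤x/q = 0≤y-x⇒x≤y (
    0≤-resp-≈ pq[x/q-y/p]≈px-yq (*-nonneg (*-nonneg (proj₁ 0<p) (proj₁ 0<q)) (x≤y⇒0≤y-x y/p≤x/q)))
    where
    open import Relation.Binary.Reasoning.Setoid setoid
    pq[x/q-y/p]≈px-yq : p * q * (x * q ⁻¹ - y * p ⁻¹) ≈ p * x - y * q
    pq[x/q-y/p]≈px-yq = begin
      p * q * (x * q ⁻¹ - y * p ⁻¹)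
        ≈⟨ solve 6 (λ p q x y p' q' → p :* q :* (x :* q' :- y :* p')
                      := p :* x :* (q :* q') :- y :* q :* (p :* p')) refl p q x y (p ⁻¹) (q ⁻¹) ⟩
      p * x * (q * q ⁻¹) - y * q * (p * p ⁻¹)
        ≈⟨ +-cong (*-congˡ (⁻¹-inverse q (<⇒≉ 0<q))) (-‿cong (*-congˡ (⁻¹-inverse p (<⇒≉ 0<p)))) ⟩
      p * x * 1# - y * q * 1#
        ≈⟨ +-cong (*-identityʳ _) (-‿cong (*-identityʳ _)) ⟩
      p * x - y * q ∎

module ThreeTermRecurrence {c ℓ} (R : RealField c ℓ) where
  open RealField R
  open RealFieldProperties R
  open ℤ-Solver commRing using (solve; _:=_; _:+_; _:-_; _:*_; :-_)
  open import Relation.Binary.Reasoning.Setoid setoid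

  ratio-bound-step : ∀ {λ₀ a b c u₀ u₁ u₂} → 0# < λ₀ → 0# < a → 0# < c → 0# < u₁ →
    a * u₂ ≈ b * u₁ - c * u₀ → a * (λ₀ * λ₀) - b * λ₀ + c ≤ 0# →
    λ₀ * u₀ ≤ u₁ → λ₀ * u₁ ≤ u₂
  ratio-bound-step {λ₀} {a} {b} {c} {u₀} {u₁} {u₂} 0<λ₀ 0<a 0<c 0<u₁ rec Q≤0 λ₀u₀≤u₁ =
    0≤y-x⇒x≤y (*-cancelˡ-nonneg 0<λ₀ (*-cancelˡ-nonneg 0<a (0≤-resp-≈ identity
      (+-nonneg (*-nonneg (proj₁ 0<c) (x≤y⇒0≤y-x λ₀u₀≤u₁))
                (*-nonneg (proj₁ 0<u₁) (x≤0⇒0≤-x Q≤0))))))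
    where
    identity : c * (u₁ - λ₀ * u₀) + u₁ * - (a * (λ₀ * λ₀) - b * λ₀ + c)
             ≈ a * (λ₀ * (u₂ - λ₀ * u₁))
    identity = begin
      c * (u₁ - λ₀ * u₀) + u₁ * - (a * (λ₀ * λ₀) - b * λ₀ + c)
        ≈⟨ solve 6 (λ λ₀ a b c u₀ u₁ →
             c :* (u₁ :- λ₀ :* u₀) :+ u₁ :* (:- (a :* (λ₀ :* λ₀) :- b :* λ₀ :+ c))
             := λ₀ :* (b :* u₁ :- c :* u₀) :- a :* (λ₀ :* λ₀) :* u₁) refl λ₀ a b c u₀ u₁ ⟩
      λ₀ * (b * u₁ - c * u₀) - a * (λ₀ * λ₀) * u₁
        ≈⟨ +-congʳ (*-congˡ rec) ⟨
      λ₀ * (a * u₂) - a * (λ₀ * λ₀) * u₁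
        ≈⟨ solve 4 (λ λ₀ a u₁ u₂ → λ₀ :* (a :* u₂) :- a :* (λ₀ :* λ₀) :* u₁
             := a :* (λ₀ :* (u₂ :- λ₀ :* u₁))) refl λ₀ a u₁ u₂ ⟩
      a * (λ₀ * (u₂ - λ₀ * u₁)) ∎

  ratio-bound-step-from-log-convexity : ∀ {B C u₀ u₁ u₂} → 0# ≤ B → 0# < u₀ → 0# ≤ u₁ →
    u₁ * u₁ ≤ u₀ * u₂ → C * u₀ ≤ B * u₁ → C * u₁ ≤ B * u₂
  ratio-bound-step-from-log-convexity {B} {C} {u₀} {u₁} {u₂} 0≤B 0<u₀ 0≤u₁ log-convex Cu₀≤Bu₁ =
    0≤y-x⇒x≤y (*-cancelˡ-nonneg 0<u₀ (0≤-resp-≈ identity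
      (+-nonneg (*-nonneg 0≤B (x≤y⇒0≤y-x log-convex)) (*-nonneg 0≤u₁ (x≤y⇒0≤y-x Cu₀≤Bu₁)))))
    where
    identity : B * (u₀ * u₂ - u₁ * u₁) + u₁ * (B * u₁ - C * u₀) ≈ u₀ * (B * u₂ - C * u₁)
    identity = solve 5 (λ B C u₀ u₁ u₂ →
      B :* (u₀ :* u₂ :- u₁ :* u₁) :+ u₁ :* (B :* u₁ :- C :* u₀) := u₀ :* (B :* u₂ :- C :* u₁))
      refl B C u₀ u₁ u₂

  log-convexity-step : ∀ {B C a₀ a₁ b₀ b₁ c₀ c₁ u₀ u₁ u₂ u₃} →
    0# < B → 0# < C → 0# < a₀ → 0# < a₁ → 0# < c₀ → 0# ≤ u₁ →
    a₀ * u₂ ≈ b₀ * u₁ - c₀ * u₀ → a₁ * u₃ ≈ b₁ * u₂ - c₁ * u₁ →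
    B * (c₁ * a₀ - c₀ * a₁) ≤ C * (b₁ * a₀ - b₀ * a₁) → 0# ≤ B * (c₁ * a₀ - c₀ * a₁) →
    u₁ * u₁ ≤ u₀ * u₂ → C * u₁ ≤ B * u₂ → u₂ * u₂ ≤ u₁ * u₃
  log-convexity-step {B} {C} {a₀} {a₁} {b₀} {b₁} {c₀} {c₁} {u₀} {u₁} {u₂} {u₃}
                     0<B 0<C 0<a₀ 0<a₁ 0<c₀ 0≤u₁ rec₀ rec₁ BCₐ≤CBₐ 0≤BCₐ log-convex Cu₁≤Bu₂ =
    0≤y-x⇒x≤y (*-cancelˡ-nonneg 0<a₁ (*-cancelˡ-nonneg 0<a₀ (*-cancelˡ-nonneg 0<B
      (0≤-resp-≈ identity (+-nonneg
        (*-nonneg 0≤u₁ (+-nonneg (*-nonneg 0≤Bₐ (x≤y⇒0≤y-x Cu₁≤Bu₂))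
                                 (*-nonneg 0≤u₁ (x≤y⇒0≤y-x BCₐ≤CBₐ))))
        (*-nonneg (*-nonneg (*-nonneg (proj₁ 0<B) (proj₁ 0<c₀)) (proj₁ 0<a₁))
                  (x≤y⇒0≤y-x log-convex)))))))
    where
    Bₐ Cₐ : Carrier
    Bₐ = b₁ * a₀ - b₀ * a₁
    Cₐ = c₁ * a₀ - c₀ * a₁
    0≤Bₐ : 0# ≤ Bₐ
    0≤Bₐ = *-cancelˡ-nonneg 0<C (≤.trans 0≤BCₐ BCₐ≤CBₐ)
    identity : u₁ * (Bₐ * (B * u₂ - C * u₁) + u₁ * (C * Bₐ - B * Cₐ))
                 + B * c₀ * a₁ * (u₀ * u₂ - u₁ * u₁)
             ≈ B * (a₀ * (a₁ * (u₁ * u₃ - u₂ * u₂)))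
    identity = begin
      u₁ * (Bₐ * (B * u₂ - C * u₁) + u₁ * (C * Bₐ - B * Cₐ)) + B * c₀ * a₁ * (u₀ * u₂ - u₁ * u₁)
        ≈⟨ solve 11 (λ B C a₀ a₁ b₀ b₁ c₀ c₁ u₀ u₁ u₂ →
             u₁ :* ((b₁ :* a₀ :- b₀ :* a₁) :* (B :* u₂ :- C :* u₁)
                    :+ u₁ :* (C :* (b₁ :* a₀ :- b₀ :* a₁) :- B :* (c₁ :* a₀ :- c₀ :* a₁)))
               :+ B :* c₀ :* a₁ :* (u₀ :* u₂ :- u₁ :* u₁)
             := B :* (a₀ :* u₁ :* (b₁ :* u₂ :- c₁ :* u₁) :- a₁ :* u₂ :* (b₀ :* u₁ :- c₀ :* u₀)))
             refl B C a₀ a₁ b₀ b₁ c₀ c₁ u₀ u₁ u₂ ⟩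
      B * (a₀ * u₁ * (b₁ * u₂ - c₁ * u₁) - a₁ * u₂ * (b₀ * u₁ - c₀ * u₀))
        ≈⟨ *-congˡ (+-cong (*-congˡ rec₁) (-‿cong (*-congˡ rec₀))) ⟨
      B * (a₀ * u₁ * (a₁ * u₃) - a₁ * u₂ * (a₀ * u₂))
        ≈⟨ solve 6 (λ B a₀ a₁ u₁ u₂ u₃ → B :* (a₀ :* u₁ :* (a₁ :* u₃) :- a₁ :* u₂ :* (a₀ :* u₂))
             := B :* (a₀ :* (a₁ :* (u₁ :* u₃ :- u₂ :* u₂)))) refl B a₀ a₁ u₁ u₂ u₃ ⟩
      B * (a₀ * (a₁ * (u₁ * u₃ - u₂ * u₂))) ∎

  -- The sequences below start at the paper's n = 1: a n stands for a(n+1),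
  -- so cross b a n is B(n+1).
  cross : (ℕ → Carrier) → (ℕ → Carrier) → ℕ → Carrier
  cross f g n = f (suc n) * g n - f n * g (suc n)

  module _ {a b c u : ℕ → Carrier} (0<a : ∀ n → 0# < a n) (0<c : ∀ n → 0# < c n)
           (rec : ∀ n → a n * u (suc (suc n)) ≈ b n * u (suc n) - c n * u n) where

    positive-above-root : ∀ {λ₀} → 0# < λ₀ → λ₀ * u 0 ≤ u 1 → 0# < λ₀ * u 0 →
      (∀ n → a n * (λ₀ * λ₀) - b n * λ₀ + c n ≤ 0#) → ∀ n → 0# < u n
    positive-above-root {λ₀} 0<λ₀ λ₀u₀≤u₁ 0<λ₀u₀ Q≤0 n = proj₁ (invariant n)
      where
      invariant : ∀ n → 0# < u n × λ₀ * u n ≤ u (suc n)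
      invariant zero    = *-cancelˡ-pos 0<λ₀ 0<λ₀u₀ , λ₀u₀≤u₁
      invariant (suc n) = 0<uₙ₊₁ , ratio-bound-step 0<λ₀ (0<a n) (0<c n) 0<uₙ₊₁ (rec n) (Q≤0 n) λ₀uₙ≤uₙ₊₁
        where
        λ₀uₙ≤uₙ₊₁ : λ₀ * u n ≤ u (suc n)
        λ₀uₙ≤uₙ₊₁ = proj₂ (invariant n)
        0<uₙ₊₁ : 0# < u (suc n)
        0<uₙ₊₁ = <-≤-trans (*-pos 0<λ₀ (proj₁ (invariant n))) λ₀uₙ≤uₙ₊₁

    log-convex : ∀ {B C} → 0# < B → 0# < C → (∀ n → 0# < u n) →
      (∀ n → B * cross c a n ≤ C * cross b a n × 0# ≤ B * cross c a n) →
      u 1 / u 0 ≤ u 2 / u 1 → C / B ≤ u 1 / u 0 →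
      ∀ n → u (suc n) * u (suc n) ≤ u n * u (suc (suc n))
    log-convex {B} {C} 0<B 0<C 0<u H u₁/u₀≤u₂/u₁ C/B≤u₁/u₀ n = proj₁ (invariant n)
      where
      invariant : ∀ n → u (suc n) * u (suc n) ≤ u n * u (suc (suc n))
                      × C * u (suc n) ≤ B * u (suc (suc n))
      invariant zero = log-convex₀ ,
        ratio-bound-step-from-log-convexity (proj₁ 0<B) (0<u 0) (proj₁ (0<u 1)) log-convex₀
          (cross-multiply 0<B (0<u 0) C/B≤u₁/u₀)
        where
        log-convex₀ : u 1 * u 1 ≤ u 0 * u 2
        log-convex₀ = cross-multiply (0<u 0) (0<u 1) u₁/u₀≤u₂/u₁
      invariant (suc n) = log-convex₁ ,
        ratio-bound-step-from-log-convexity (proj₁ 0<B) (0<u (suc n)) (proj₁ (0<u (suc (suc n)))) log-convex₁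
          (proj₂ (invariant n))
        where
        log-convex₁ : u (suc (suc n)) * u (suc (suc n)) ≤ u (suc n) * u (suc (suc (suc n)))
        log-convex₁ = log-convexity-step 0<B 0<C (0<a n) (0<a (suc n)) (0<c n)
          (proj₁ (0<u (suc n))) (rec n) (rec (suc n)) (proj₁ (H n)) (proj₂ (H n))
          (proj₁ (invariant n)) (proj₂ (invariant n))

proposition3p7 : ∀ {c ℓ} (R : RealField c ℓ) → let open RealField R in
  -- δ = suc d ≥ 1; pa, pb, pc are the coefficient functions of a, b, c
  (d : ℕ) (pa pb pc : ℕ → Carrier) (u : ℕ → Carrier) →
  let δ = suc d
      a = pa δ
      a' = pa d
      b = pb δ
      b' = pb d
      c = pc δ
      c' = pc d
      aₙ = λ (n : ℕ) → eval δ pa (ι n)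
      bₙ = λ (n : ℕ) → eval δ pb (ι n)
      cₙ = λ (n : ℕ) → eval δ pc (ι n)
      Bₙ = λ (n : ℕ) → bₙ (suc n) * aₙ n - bₙ n * aₙ (suc n)
      Cₙ = λ (n : ℕ) → cₙ (suc n) * aₙ n - cₙ n * aₙ (suc n)
      B = b * a' - b' * a
      C = c * a' - c' * a
      Q = λ (n : ℕ) (t : Carrier) → aₙ n * (t * t) - bₙ n * t + cₙ n
      λ₀ = C / B
  in
  -- positive leading coefficients
  0# < a → 0# < b → 0# < c →
  -- positive values at all integers n ≥ 1
  (∀ n → 0# < aₙ (suc n)) → (∀ n → 0# < bₙ (suc n)) → (∀ n → 0# < cₙ (suc n)) →
  -- recurrence a(n) u_{n+1} = b(n) u_n - c(n) u_{n-1}, n ≥ 1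
  (∀ n → aₙ (suc n) * u (suc (suc n)) ≈ bₙ (suc n) * u (suc n) - cₙ (suc n) * u n) →
  0# < B → 0# < C →
  -- (i)
  ((λ₀ * u 0 ≤ u 1 × 0# < λ₀ * u 0) →
     (∀ n → Q (suc n) λ₀ ≤ 0#) →
     ∀ n → 0# < u n)
  ×
  -- (ii)
  ((∀ n → 0# < u n) →
     (∀ n → B * Cₙ (suc n) ≤ C * Bₙ (suc n) × 0# ≤ B * Cₙ (suc n)) →
     (u 1 / u 0 ≤ u 2 / u 1 × λ₀ ≤ u 1 / u 0) →
     ∀ n → u (suc n) * u (suc n) ≤ u n * u (suc (suc n)))
proposition3p7 R d pa pb pc u _ _ _ 0<a _ 0<c rec 0<B 0<C =
    (λ (λ₀u₀≤u₁ , 0<λ₀u₀) → positive-above-root 0<a 0<c rec (/-pos 0<C 0<B) λ₀u₀≤u₁ 0<λ₀u₀)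
  , (λ 0<u H (r₁ , r₂) → log-convex 0<a 0<c rec 0<B 0<C 0<u H r₁ r₂)
  where
  open RealFieldProperties R using (/-pos)
  open ThreeTermRecurrence R using (positive-above-root; log-convex)
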